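{- Let $n$ and $b$ be positive integers and $r$ a prime with $n/2<r^b\le n$. If $d$ is a divisor of $n$ with $1<d<n$ that is not a power of $r$, then $r$ divides $I_{n,d}=\dfrac{n!}{(d!)^{n/d}\,(n/d)!}$.
   Context: $I_{n,d}$ is the number of partitions of an $n$-element set into $n/d$ blocks each of size $d$. -}

module Defs where

open import Data.Nat using (ℕ; _*_; _^_; _!; NonZero)
open import Data.Nat.DivMod using (_/_)
open import Data.Nat.Properties using (m^n≢0; m*n≢0; _!≢0)

-- I n d = n! / ((d!)^(n/d) * (n/d)!), the number of partitions of an
-- n-element set into n/d blocks each of size d (when d ∣ n, d > 0).
I : ℕ → (d : ℕ) → .{{NonZero d}} → ℕ
I n d = (n !) / (((d !) ^ (n / d)) * ((n / d) !))
  where instance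
    nz0 : NonZero (d !)
    nz0 = d !≢0
    nz1 : NonZero ((d !) ^ (n / d))
    nz1 = m^n≢0 (d !) (n / d)
    nz2 : NonZero ((n / d) !)
    nz2 = (n / d) !≢0
    nz3 : NonZero (((d !) ^ (n / d)) * ((n / d) !))
    nz3 = m*n≢0 _ _

-- Counting partitions block by block gives I (m d) d = ∏_{j<m} C(jd + d − 1, d − 1):
-- the least element not yet placed chooses its d − 1 partners among the others.
-- Since d is not a power of r it does not divide q = r ^ b, and d < q ≤ n, so q lies
-- strictly inside a block: jd < q < (j + 1) d with j < m.  The factor for that block is
-- C(q + a, d − 1) with a < d − 1 < q, which r divides: by Pascal's rule C(q + a, k) ≡ C(a, k)
-- = 0 modulo r, because r divides C(q, k) for 0 < k < q.
module Submission where

open import Defs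
open import Data.Nat using (ℕ; _*_; _^_; _<_; _≤_; NonZero)
open import Data.Nat.Divisibility using (_∣_)
open import Data.Nat.Primality using (Prime)
open import Data.Product using (∃)
open import Relation.Binary.PropositionalEquality using (_≡_)
open import Relation.Nullary using (¬_)

open import Algebra.Properties.CommutativeSemigroup using (xy∙z≈xz∙y)
open import Data.Nat.Base using (zero; suc; _+_; _∸_; _!; s≤s; s≤s⁻¹; z<s; s<s; >-nonZero)
open import Data.Nat.Properties
open import Data.Nat.Combinatorics
  using (_C_; nCk≡n!/k![n-k]!; k>n⇒nCk≡0; k![n∸k]!∣n!; nCk+nC[k+1]≡[n+1]C[k+1])
open import Data.Nat.Coprimality using (Coprime; coprime-divisor)
import Data.Nat.Coprimality as Coprime
open import Data.Nat.Divisibility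
  using (divides; divides-refl; _∣?_; _∣0; ∣1⇒≡1; ∣⇒≤; ∣-trans; m∣m*n; n∣m*n; ∣m∣n⇒∣m+n; *-cancelʳ-∣; m%n≡0⇒n∣m)
open import Data.Nat.DivMod using (_/_; _%_; m/n*n≡m; m*n/n≡m; /-congˡ; m%n<n; m≡m%n+[m/n]*n; m<n*o⇒m/o<n)
open import Data.Nat.Primality using (prime⇒irreducible; prime⇒nonZero)
open import Data.Nat.Tactic.RingSolver using (solve-∀)
open import Data.Product using (_,_; proj₁; proj₂)
open import Data.Sum using (inj₁; inj₂)
open import Relation.Nullary using (yes; no; contradiction)
open import Relation.Binary.PropositionalEquality using (refl; sym; trans; cong; subst; module ≡-Reasoning)
open ≡-Reasoning

private variable p m n k : ℕ

¬∣⇒coprime : Prime p → ¬ p ∣ m → Coprime p m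
¬∣⇒coprime pp ¬p∣m (i∣p , i∣m) with prime⇒irreducible pp i∣p
... | inj₁ i≡1  = i≡1
... | inj₂ refl = contradiction i∣m ¬p∣m

∣p^n⇒≡p^k : ∀ {d} → Prime p → ∀ n → d ∣ p ^ n → ∃ λ k → d ≡ p ^ k
∣p^n⇒≡p^k pp zero d∣1 = 0 , ∣1⇒≡1 d∣1
∣p^n⇒≡p^k {p} {d} pp (suc n) d∣p^[1+n] with p ∣? d
... | yes (divides-refl d′) =
  let k , d′≡p^k = ∣p^n⇒≡p^k pp n d′∣p^n in suc k , trans (cong (_* p) d′≡p^k) (*-comm (p ^ k) p)
  where
  instance _ = prime⇒nonZero pp
  d′∣p^n : d′ ∣ p ^ n
  d′∣p^n = *-cancelʳ-∣ p (subst (d′ * p ∣_) (*-comm p (p ^ n)) d∣p^[1+n])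
... | no ¬p∣d = ∣p^n⇒≡p^k pp n (coprime-divisor (Coprime.sym (¬∣⇒coprime pp ¬p∣d)) d∣p^[1+n])

¬∣⇒coprime-^ : Prime p → ¬ p ∣ m → ∀ k → Coprime (p ^ k) m
¬∣⇒coprime-^ pp ¬p∣m k (i∣p^k , i∣m) with ∣p^n⇒≡p^k pp k i∣p^k
... | zero  , i≡1  = i≡1
... | suc j , refl = contradiction (∣-trans (m∣m*n (_ ^ j)) i∣m) ¬p∣m

p^k∣m*n∧¬p∣n⇒p^k∣m : Prime p → ∀ k → p ^ k ∣ m * n → ¬ p ∣ n → p ^ k ∣ m
p^k∣m*n∧¬p∣n⇒p^k∣m {p} {m} {n} pp k p^k∣mn ¬p∣n =
  coprime-divisor (¬∣⇒coprime-^ pp ¬p∣n k) (subst (p ^ k ∣_) (*-comm m n) p^k∣mn)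

nCk*[k!*[n∸k]!]≡n! : k ≤ n → (n C k) * (k ! * (n ∸ k) !) ≡ n !
nCk*[k!*[n∸k]!]≡n! {k} {n} k≤n = begin
  (n C k) * (k ! * (n ∸ k) !)                 ≡⟨ cong (_* (k ! * (n ∸ k) !)) (nCk≡n!/k![n-k]! k≤n) ⟩
  n ! / (k ! * (n ∸ k) !) * (k ! * (n ∸ k) !) ≡⟨ m/n*n≡m (k![n∸k]!∣n! k≤n) ⟩
  n !                                         ∎
  where instance _ = k !* (n ∸ k) !≢0

[1+k]*[1+n]C[1+k]≡[1+n]*nCk : ∀ n k → suc k * (suc n C suc k) ≡ suc n * (n C k)
[1+k]*[1+n]C[1+k]≡[1+n]*nCk n k with k ≤? n
... | no k≰n = begin
  suc k * (suc n C suc k) ≡⟨ cong (suc k *_) (k>n⇒nCk≡0 (s<s (≰⇒> k≰n))) ⟩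
  suc k * 0               ≡⟨ *-zeroʳ (suc k) ⟩
  0                       ≡⟨ *-zeroʳ (suc n) ⟨
  suc n * 0               ≡⟨ cong (suc n *_) (k>n⇒nCk≡0 (≰⇒> k≰n)) ⟨
  suc n * (n C k)         ∎
... | yes k≤n = *-cancelʳ-≡ _ _ (k ! * (n ∸ k) !) (begin
  suc k * X * (k ! * (n ∸ k) !)         ≡⟨ regroup (suc k) X (k !) ((n ∸ k) !) ⟩
  X * ((suc k) ! * (suc n ∸ suc k) !)   ≡⟨ nCk*[k!*[n∸k]!]≡n! (s≤s k≤n) ⟩
  (suc n) !                             ≡⟨ cong (suc n *_) (nCk*[k!*[n∸k]!]≡n! k≤n) ⟨
  suc n * ((n C k) * (k ! * (n ∸ k) !)) ≡⟨ *-assoc (suc n) (n C k) _ ⟨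
  suc n * (n C k) * (k ! * (n ∸ k) !)   ∎)
  where
  X = suc n C suc k
  instance _ = k !* (n ∸ k) !≢0
  regroup : ∀ a x b c → a * x * (b * c) ≡ x * (a * b * c)
  regroup = solve-∀

n∣k*nCk : ∀ n k → .{{NonZero n}} → n ∣ k * (n C k)
n∣k*nCk (suc n) zero    = suc n ∣0
n∣k*nCk (suc n) (suc k) =
  divides (n C k) (trans ([1+k]*[1+n]C[1+k]≡[1+n]*nCk n k) (*-comm (suc n) (n C k)))

p∣p^bCk : Prime p → ∀ b → 0 < k → k < p ^ b → p ∣ (p ^ b) C k
p∣p^bCk {p} {k} pp b 0<k k<p^b with p ∣? ((p ^ b) C k)
... | yes p∣C = p∣C
... | no ¬p∣C = contradiction (∣⇒≤ p^b∣k) (<⇒≱ k<p^b)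
  where
  instance
    _ = >-nonZero 0<k
    _ = m^n≢0 p b {{prime⇒nonZero pp}}
  p^b∣k : p ^ b ∣ k
  p^b∣k = p^k∣m*n∧¬p∣n⇒p^k∣m pp b (n∣k*nCk (p ^ b) k) ¬p∣C

p∣[p^b+a]Ck : Prime p → ∀ b a → a < k → k < p ^ b → p ∣ (p ^ b + a) C k
p∣[p^b+a]Ck {p} {k} pp b zero 0<k k<p^b rewrite +-identityʳ (p ^ b) = p∣p^bCk pp b 0<k k<p^b
p∣[p^b+a]Ck {p} {suc k} pp b (suc a) (s<s a<k) k<p^b
  rewrite +-suc (p ^ b) a | sym (nCk+nC[k+1]≡[n+1]C[k+1] (p ^ b + a) k) =
  ∣m∣n⇒∣m+n (p∣[p^b+a]Ck pp b a a<k (<-trans (n<1+n k) k<p^b))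
            (p∣[p^b+a]Ck pp b a (m<n⇒m<1+n a<k) k<p^b)

-- The block-by-block count of partitions of an (m (e + 1))-element set into blocks of size e + 1.
blockChoices : ℕ → ℕ → ℕ
blockChoices e zero    = 1
blockChoices e (suc j) = blockChoices e j * ((e + j * suc e) C e)

[m*d]!≡blockChoices*[d!^m*m!] : ∀ e m → (m * suc e) ! ≡ blockChoices e m * (((suc e) !) ^ m * m !)
[m*d]!≡blockChoices*[d!^m*m!] e zero = refl
[m*d]!≡blockChoices*[d!^m*m!] e (suc m) = begin
  suc m * d * (e + m * d) !
    ≡⟨ cong (suc m * d *_) (nCk*[k!*[n∸k]!]≡n! (m≤m+n e (m * d))) ⟨
  suc m * d * (B * (e ! * (e + m * d ∸ e) !))
    ≡⟨ cong (λ x → suc m * d * (B * (e ! * x !))) (m+n∸m≡n e (m * d)) ⟩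
  suc m * d * (B * (e ! * (m * d) !))
    ≡⟨ cong (λ x → suc m * d * (B * (e ! * x))) ([m*d]!≡blockChoices*[d!^m*m!] e m) ⟩
  suc m * d * (B * (e ! * (Q * ((d !) ^ m * m !))))
    ≡⟨ regroup (suc m) d B (e !) Q ((d !) ^ m) (m !) ⟩
  Q * B * (d * e ! * (d !) ^ m * (suc m * m !)) ∎
  where
  d = suc e
  B = (e + m * d) C e
  Q = blockChoices e m
  regroup : ∀ m′ d′ c f q g h → m′ * d′ * (c * (f * (q * (g * h)))) ≡ q * c * (d′ * f * g * (m′ * h))
  regroup = solve-∀

I≡blockChoices : ∀ e m → I (m * suc e) (suc e) ≡ blockChoices e m
I≡blockChoices e m =
  trans (/-congˡ [m*d]!≡blockChoices*blocks) (m*n/n≡m (blockChoices e m) (blocks (m * d / d)))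
  where
  d = suc e
  blocks : ℕ → ℕ
  blocks k = (d !) ^ k * k !
  instance
    _ : NonZero (blocks (m * d / d))
    _ = m*n≢0 ((d !) ^ (m * d / d)) ((m * d / d) !)
          {{m^n≢0 (d !) (m * d / d) {{d !≢0}}}} {{(m * d / d) !≢0}}
  [m*d]!≡blockChoices*blocks : (m * d) ! ≡ blockChoices e m * blocks (m * d / d)
  [m*d]!≡blockChoices*blocks = subst (λ k → (m * d) ! ≡ blockChoices e m * blocks k)
    (sym (m*n/n≡m m d)) ([m*d]!≡blockChoices*[d!^m*m!] e m)

C∣blockChoices : ∀ e {j m} → j < m → (e + j * suc e) C e ∣ blockChoices e m
C∣blockChoices e {j} {suc m} j<1+m with m<1+n⇒m<n∨m≡n j<1+m
... | inj₁ j<m  = ∣-trans (C∣blockChoices e j<m) (m∣m*n ((e + m * suc e) C e))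
... | inj₂ refl = n∣m*n (blockChoices e j)

p∣[e+[p^b/d]*d]Ce : Prime p → ∀ b e → suc e < p ^ b → ¬ suc e ∣ p ^ b →
                    p ∣ (e + (p ^ b / suc e) * suc e) C e
p∣[e+[p^b/d]*d]Ce {p} pp b e d<q d∤q with p ^ b % suc e in q%d≡ρ
... | zero  = contradiction (m%n≡0⇒n∣m (p ^ b) (suc e) q%d≡ρ) d∤q
... | suc ρ = subst (λ n → p ∣ n C e) (sym e+t*d≡q+a) (p∣[p^b+a]Ck pp b a a<e (<-trans (n<1+n e) d<q))
  where
  q = p ^ b
  d = suc e
  t = q / d
  ρ<e : suc ρ ≤ e
  ρ<e = s≤s⁻¹ (subst (_< d) q%d≡ρ (m%n<n q d))
  a = proj₁ (m≤n⇒∃[o]m+o≡n ρ<e)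
  ρ+a≡e : suc ρ + a ≡ e
  ρ+a≡e = proj₂ (m≤n⇒∃[o]m+o≡n ρ<e)
  a<e : a < e
  a<e = subst (a <_) ρ+a≡e (m<n+m a z<s)
  e+t*d≡q+a : e + t * d ≡ q + a
  e+t*d≡q+a = begin
    e + t * d         ≡⟨ cong (_+ t * d) ρ+a≡e ⟨
    suc ρ + a + t * d ≡⟨ xy∙z≈xz∙y +-commutativeSemigroup (suc ρ) a (t * d) ⟩
    suc ρ + t * d + a ≡⟨ cong (λ r → r + t * d + a) q%d≡ρ ⟨
    q % d + t * d + a ≡⟨ cong (_+ a) (m≡m%n+[m/n]*n q d) ⟨
    q + a             ∎

corollary3p3 : (n b r d : ℕ) → 0 < n → 0 < b → Prime r → n < 2 * r ^ b → r ^ b ≤ n → d ∣ n → 1 < d → d < n → ¬ (∃ λ k → d ≡ r ^ k) → .{{_ : NonZero d}} → r ∣ I n d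
corollary3p3 n b r zero _ _ _ _ _ _ () _ _
corollary3p3 .(m * suc e) b r (suc e) _ _ pr n<2q q≤n (divides-refl m) _ d<n d≢r^k =
  subst (r ∣_) (sym (I≡blockChoices e m))
    (∣-trans (p∣[e+[p^b/d]*d]Ce pr b e d<q d∤q) (C∣blockChoices e t<m))
  where
  d = suc e
  q = r ^ b
  d∤q : ¬ d ∣ q
  d∤q d∣q = d≢r^k (∣p^n⇒≡p^k pr b d∣q)
  1<m : 1 < m
  1<m = *-cancelʳ-< d 1 m (subst (_< m * d) (sym (*-identityˡ d)) d<n)
  d<q : d < q
  d<q = *-cancelˡ-< 2 d q (≤-<-trans (*-monoˡ-≤ d 1<m) n<2q)
  t<m : q / d < m
  t<m = m<n*o⇒m/o<n (≤∧≢⇒< q≤n (λ q≡m*d → d∤q (divides m q≡m*d)))
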